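{- The maps $\partial_{\mathrm{del}}$ and $\partial_{\mathrm{con}}$ on $\mathcal M_{\bullet,\bullet}$ are differentials, i.e. $\partial_{\mathrm{del}}^2=0$ and $\partial_{\mathrm{con}}^2=0$, of bidegrees $(-1,0)$ and $(0,-1)$ respectively.
   Context: Matroids have finite ground set $E(\mathsf M)$, rank $\mathrm{rk}$ and nullity $|E(\mathsf M)|-\mathrm{rk}(\mathsf M)$. An orientation of $\mathsf M$ is a generator $\eta$ of $\bigwedge^{|E|}\mathbb{Z}\langle E\rangle$, $E=E(\mathsf M)$. $\mathcal M$ is the $\mathbb{Q}$-vector space spanned by symbols $[\mathsf M,\eta]$ modulo $[\mathsf M,-\eta]=-[\mathsf M,\eta]$ and $[\mathsf M,\eta]=[\mathsf M',\psi_*\eta]$ for every matroid isomorphism $\psi:\mathsf M\to\mathsf M'$ ($\psi_*$ the induced map on top exterior powers), bigraded by $\mathcal M_{k,r}$ (nullity $k$, rank $r$). With $\iota_x$ interior product ($\iota_x(x\wedge\alpha)=\alpha$, extended with the usual signs), the linear maps $\partial_{\mathrm{del}}[\mathsf M,\eta]=\sum_{x\in E,\ x\text{ not a coloop}}[\mathsf M\setminus x,\iota_x\eta]$ and $\partial_{\mathrm{con}}[\mathsf M,\eta]=\sum_{x\in E,\ x\text{ not a loop}}[\mathsf M/x,\iota_x\eta]$ are well defined on $\mathcal M$. -}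

module Defs where

open import Data.Nat using (ℕ; zero; suc; _∸_; _≤_; _<_; _+_; _<ᵇ_; _≟_; _<?_)
open import Data.Bool using (Bool; true; false; if_then_else_; _∧_)
open import Data.Fin using (Fin; toℕ)
open import Data.Fin.Subset using (Subset; _⊆_; _∪_; _∩_; ∁; ⁅_⁆; ∣_∣; ⊤)
open import Data.Fin.Permutation using (Permutation; _⟨$⟩ʳ_; _⟨$⟩ˡ_)
open import Data.Vec using (insertAt; tabulate; lookup)
open import Data.List using (List; []; _∷_; [_]; _++_; map; concatMap; allFin)
open import Data.Nat.ListAction using (sum)
open import Data.List.Relation.Binary.Permutation.Propositional using (_↭_)
open import Data.Product using (_×_; _,_)
open import Data.Sign using (Sign; opposite) renaming (_*_ to _*ˢ_)
import Data.Sign as Sign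
open import Data.Rational using (ℚ; 0ℚ; -_) renaming (_+_ to _+ℚ_)
open import Relation.Nullary.Decidable using (does)
open import Relation.Binary.PropositionalEquality using (_≡_)

record IsMatroid (n : ℕ) (rk : Subset n → ℕ) : Set where
  field
    rk-bounded    : ∀ S → rk S ≤ ∣ S ∣
    rk-monotone   : ∀ {S T} → S ⊆ T → rk S ≤ rk T
    rk-submodular : ∀ S T → rk (S ∪ T) + rk (S ∩ T) ≤ rk S + rk T

rank : ∀ {n} → (Subset n → ℕ) → ℕ
rank rk = rk ⊤

nullity : ∀ n → (Subset n → ℕ) → ℕ
nullity n rk = n ∸ rank rk

IsLoop : ∀ {n} → (Subset n → ℕ) → Fin n → Set
IsLoop rk x = rk ⁅ x ⁆ ≡ 0

IsColoop : ∀ {n} → (Subset n → ℕ) → Fin n → Set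
IsColoop rk x = rk (∁ ⁅ x ⁆) < rk ⊤

-- deletion and contraction of x; the ground set Fin (suc n) ∖ {x} is
-- identified with Fin n by the order preserving bijection (punchIn x).
delete : ∀ {n} → (Subset (suc n) → ℕ) → Fin (suc n) → Subset n → ℕ
delete rk x S = rk (insertAt S x false)

contract : ∀ {n} → (Subset (suc n) → ℕ) → Fin (suc n) → Subset n → ℕ
contract rk x S = rk (insertAt S x true) ∸ rk ⁅ x ⁆

-- Oriented matroids-with-orientation generators.  On E = Fin n an
-- orientation is η = s · (e₀ ∧ … ∧ e_{n-1}) with a sign s.

record OM : Set where
  constructor om
  field
    size : ℕ
    rk   : Subset size → ℕ
    sgn  : Sign

open OM public

signPow : ℕ → Sign
signPow zero = Sign.+
signPow (suc k) = opposite (signPow k)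

-- interior product: ι_x (e₀ ∧ … ∧ e_n) = (-1)^x e₀ ∧ … ê_x … ∧ e_n,
-- the remaining ordered basis being relabelled to Fin n via punchIn x.
ιsign : ∀ {n} → Fin n → Sign → Sign
ιsign x s = signPow (toℕ x) *ˢ s

-- sign of a bijection Fin m → Fin n (number of inversions);
-- ψ_* (e₀ ∧ … ∧ e_{m-1}) = sign ψ · (e₀ ∧ … ∧ e_{n-1})
inversions : ∀ {m n} → Permutation m n → ℕ
inversions {m} σ =
  sum (map (λ i → sum (map (λ j →
    if (toℕ i <ᵇ toℕ j) ∧ (toℕ (σ ⟨$⟩ʳ j) <ᵇ toℕ (σ ⟨$⟩ʳ i)) then 1 else 0)
    (allFin m))) (allFin m))

signPerm : ∀ {m n} → Permutation m n → Sign
signPerm σ = signPow (inversions σ)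

image : ∀ {m n} → Permutation m n → Subset m → Subset n
image σ S = tabulate (λ j → lookup S (σ ⟨$⟩ˡ j))

-- Formal ℚ-linear combinations and the relation defining 𝓜.

Comb : Set
Comb = List (ℚ × OM)

infix 4 _≈_
data _≈_ : Comb → Comb → Set where
  ≈-refl  : ∀ {xs} → xs ≈ xs
  ≈-sym   : ∀ {xs ys} → xs ≈ ys → ys ≈ xs
  ≈-trans : ∀ {xs ys zs} → xs ≈ ys → ys ≈ zs → xs ≈ zs
  -- free ℚ-vector space structure
  ≈-perm  : ∀ {xs ys} → xs ↭ ys → xs ≈ ys
  ≈-++    : ∀ {xs ys} zs → xs ≈ ys → zs ++ xs ≈ zs ++ ys
  ≈-merge : ∀ a b g → (a , g) ∷ (b , g) ∷ [] ≈ [ (a +ℚ b , g) ]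
  ≈-zero  : ∀ g → [ (0ℚ , g) ] ≈ []
  ≈-orient : ∀ a n rk s → IsMatroid n rk →
             [ (a , om n rk (opposite s)) ] ≈ [ (- a , om n rk s) ]
  ≈-iso : ∀ a n n' rk rk' s → IsMatroid n rk → IsMatroid n' rk' →
          (ψ : Permutation n n') → (∀ S → rk' (image ψ S) ≡ rk S) →
          [ (a , om n rk s) ] ≈ [ (a , om n' rk' (signPerm ψ *ˢ s)) ]

∂del₁ : ℚ × OM → Comb
∂del₁ (q , om zero rk s) = []
∂del₁ (q , om (suc n) rk s) =
  concatMap (λ x → if does (rk (∁ ⁅ x ⁆) <? rk ⊤) then []
                   else [ (q , om n (delete rk x) (ιsign x s)) ])
            (allFin (suc n))

∂con₁ : ℚ × OM → Comb
∂con₁ (q , om zero rk s) = []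
∂con₁ (q , om (suc n) rk s) =
  concatMap (λ x → if does (rk ⁅ x ⁆ ≟ 0) then []
                   else [ (q , om n (contract rk x) (ιsign x s)) ])
            (allFin (suc n))

∂del : Comb → Comb
∂del = concatMap ∂del₁

∂con : Comb → Comb
∂con = concatMap ∂con₁

IsMatroidTerm : ℚ × OM → Set
IsMatroidTerm (q , g) = IsMatroid (size g) (rk g)

-- Removing x and then y from a matroid removes the same two points as removing
-- them in the other order: after relabelling by punchIn, the pairs (i, j+1) and
-- (j+1, i), i ≤ j, give extensionally equal matroids whose orientations differ by
-- one sign, ι_i ι_{j+1} = - ι_j ι_i.  Whether both removals are allowed (no
-- coloop, resp. no loop, on the way) depends only on the two points:
-- rk (E ∖ {x, y}) = rk E for deletion, rk {x, y} = 2 for contraction.  So the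
-- terms of ∂² cancel in pairs, by [M, -η] = -[M, η] and the identity isomorphism
-- between the two double removals.
module Submission where

open import Defs
open import Data.Bool using (Bool; true; false; if_then_else_; _∧_; _∨_)
open import Data.Bool.Properties using (∨-idem; ∧-idem)
open import Data.Fin as Fin using (Fin; zero; suc; toℕ; inject₁)
open import Data.Fin.Permutation using () renaming (id to idₚ)
open import Data.Fin.Properties using (toℕ-inject₁)
open import Data.Fin.Subset using (Subset; _⊆_; _∪_; _∩_; ∁; ⁅_⁆; ∣_∣; ⊤; ⊥)
open import Data.Fin.Subset.Properties
  using (⊆⊤; ⊥⊆; ∣⊤∣≡n; ∣⁅x⁆∣≡1; drop-∷-⊆; ∪-identityˡ)
open import Data.List using (List; []; _∷_; [_]; _++_; map; concat; concatMap; allFin)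
open import Data.List.Properties
  using (++-assoc; ++-identityʳ; concatMap-cong; concatMap-++; map-tabulate)
open import Data.List.Membership.Propositional using (_∈_)
open import Data.List.Membership.Propositional.Properties using (∈-++⁻; ∈-concatMap⁻)
open import Data.List.Relation.Binary.Permutation.Propositional
  using (_↭_; ↭-refl; ↭-sym; module PermutationReasoning)
open import Data.List.Relation.Binary.Permutation.Propositional.Properties
  using (++⁺ˡ; ++⁺ʳ; ++-comm; shifts)
open import Data.List.Relation.Unary.All using (All; []; _∷_)
open import Data.List.Relation.Unary.Any using (here; satisfied)
open import Data.Nat using (ℕ; zero; suc; _+_; _∸_; _≤_; _<_; _<ᵇ_; _≟_; _<?_; z≤n; s≤s; s≤s⁻¹)
open import Data.Nat.ListAction using (sum)
open import Data.Nat.Properties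
  using (≤-trans; ≤-antisym; ≤-<-trans; <-≤-trans; ≮⇒≥; n≢0⇒n>0; m≤m+n; +-suc; ∸-monoˡ-≤;
         ∸-+-assoc; +-∸-assoc; m+[n∸m]≡n; m≤n+o⇒m∸n≤o; m∸n≡0⇒m≤n; m≤n⇒m∸n≡0)
open import Data.Product using (_×_; _,_; ∃-syntax)
open import Data.Rational using (ℚ; 0ℚ; -_) renaming (_+_ to _+ℚ_)
open import Data.Rational.Properties using (+-inverseʳ)
open import Data.Sign using (Sign; opposite) renaming (_*_ to _*ˢ_)
import Data.Sign as Sign
open import Data.Sum using (_⊎_; inj₁; inj₂)
open import Data.Vec using (Vec; _∷_; here; there; insertAt; replicate; zipWith)
open import Data.Vec.Properties using (map-insertAt; map-replicate; tabulate∘lookup)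
open import Function using (_∘_; id)
open import Function.Bundles using (_⇔_; mk⇔)
open import Function.Properties.Equivalence using () renaming (trans to ⇔-trans; sym to ⇔-sym)
open import Level using (0ℓ)
open import Relation.Binary.Bundles using (Setoid)
open import Relation.Binary.PropositionalEquality
  using (_≡_; _≗_; refl; sym; trans; cong; cong₂; subst; subst₂; module ≡-Reasoning)
import Relation.Binary.Reasoning.Setoid as SetoidReasoning
open import Relation.Nullary using (¬_; Dec; yes; no; does)
open import Relation.Nullary.Decidable using (_⊎-dec_; does-⇔)

private
  variable
    A B C : Set
    n : ℕ

unless : Bool → List A → List A
unless b xs = if b then [] else xs

unless-[] : ∀ b → unless {A} b [] ≡ []
unless-[] true  = refl
unless-[] false = refl

unless-unless : ∀ a b (xs : List A) → unless a (unless b xs) ≡ unless (a ∨ b) xs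
unless-unless true  b xs = refl
unless-unless false b xs = refl

∈-unless : ∀ {P : Set} {v} {xs : List A} (p? : Dec P) → v ∈ unless (does p?) xs → ¬ P × v ∈ xs
∈-unless (no ¬p) v∈xs = ¬p , v∈xs

concatMap-[] : ∀ (xs : List A) → concatMap {B = B} (λ _ → []) xs ≡ []
concatMap-[] []       = refl
concatMap-[] (x ∷ xs) = concatMap-[] xs

concatMap-unless : ∀ (f : A → List B) b xs → concatMap f (unless b xs) ≡ unless b (concatMap f xs)
concatMap-unless f true  xs = refl
concatMap-unless f false xs = refl

unless-concatMap : ∀ (f : A → List B) b xs → unless b (concatMap f xs) ≡ concatMap (unless b ∘ f) xs
unless-concatMap f true  xs = sym (concatMap-[] xs)
unless-concatMap f false xs = refl

concatMap-concatMap : ∀ (g : B → List C) (f : A → List B) xs →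
                      concatMap g (concatMap f xs) ≡ concatMap (concatMap g ∘ f) xs
concatMap-concatMap g f []       = refl
concatMap-concatMap g f (x ∷ xs) =
  trans (concatMap-++ g (f x) (concatMap f xs)) (cong (concatMap g (f x) ++_) (concatMap-concatMap g f xs))

concatMap-allFin-suc : ∀ (f : Fin (suc n) → List A) →
                       concatMap f (allFin (suc n)) ≡ f zero ++ concatMap (f ∘ suc) (allFin n)
concatMap-allFin-suc f =
  cong (λ xss → f zero ++ concat xss) (trans (map-tabulate suc f) (sym (map-tabulate id (f ∘ suc))))

concatMap-++-↭ : ∀ (f g : A → List B) xs →
                 concatMap (λ x → f x ++ g x) xs ↭ concatMap f xs ++ concatMap g xs
concatMap-++-↭ f g []       = ↭-refl
concatMap-++-↭ f g (x ∷ xs) = begin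
  (f x ++ g x) ++ concatMap (λ x → f x ++ g x) xs  ↭⟨ ++⁺ˡ (f x ++ g x) (concatMap-++-↭ f g xs) ⟩
  (f x ++ g x) ++ F ++ G                           ≡⟨ ++-assoc (f x) (g x) (F ++ G) ⟩
  f x ++ g x ++ F ++ G                             ↭⟨ ++⁺ˡ (f x) (shifts (g x) F) ⟩
  f x ++ F ++ g x ++ G                             ≡⟨ ++-assoc (f x) F (g x ++ G) ⟨
  (f x ++ F) ++ g x ++ G                           ∎
  where
  open PermutationReasoning
  F = concatMap f xs
  G = concatMap g xs

insertAt-insertAt : ∀ (xs : Vec A n) {i j : Fin (suc n)} a b → i Fin.≤ j →
                    insertAt (insertAt xs j b) (inject₁ i) a ≡ insertAt (insertAt xs i a) (suc j) b
insertAt-insertAt xs       {zero}          a b _         = refl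
insertAt-insertAt (x ∷ xs) {suc i} {suc j} a b (s≤s i≤j) = cong (x ∷_) (insertAt-insertAt xs a b i≤j)

zipWith-insertAt : ∀ (f : A → B → C) (xs : Vec A n) ys i a b →
                   zipWith f (insertAt xs i a) (insertAt ys i b) ≡ insertAt (zipWith f xs ys) i (f a b)
zipWith-insertAt f xs       ys       zero    a b = refl
zipWith-insertAt f (x ∷ xs) (y ∷ ys) (suc i) a b = cong (f x y ∷_) (zipWith-insertAt f xs ys i a b)

insertAt-replicate : ∀ (i : Fin (suc n)) (a : A) → insertAt (replicate n a) i a ≡ replicate (suc n) a
insertAt-replicate         zero    a = refl
insertAt-replicate {suc n} (suc i) a = cong (a ∷_) (insertAt-replicate i a)

⁅⁆≡insertAt-⊥ : ∀ (i : Fin (suc n)) → ⁅ i ⁆ ≡ insertAt ⊥ i true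
⁅⁆≡insertAt-⊥         zero    = refl
⁅⁆≡insertAt-⊥ {suc n} (suc i) = cong (false ∷_) (⁅⁆≡insertAt-⊥ i)

∁⁅⁆≡insertAt-⊤ : ∀ (i : Fin (suc n)) → ∁ ⁅ i ⁆ ≡ insertAt ⊤ i false
∁⁅⁆≡insertAt-⊤ {n} i = begin
  ∁ ⁅ i ⁆                   ≡⟨ cong ∁ (⁅⁆≡insertAt-⊥ i) ⟩
  ∁ (insertAt ⊥ i true)     ≡⟨ map-insertAt _ true ⊥ i ⟩
  insertAt (∁ ⊥) i false    ≡⟨ cong (λ S → insertAt S i false) (map-replicate _ false n) ⟩
  insertAt ⊤ i false        ∎
  where open ≡-Reasoning

⁅⁆-insertAt-comm : ∀ {i j : Fin (suc n)} → i Fin.≤ j →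
                   insertAt ⁅ j ⁆ (inject₁ i) true ≡ insertAt ⁅ i ⁆ (suc j) true
⁅⁆-insertAt-comm {i = i} {j} i≤j = begin
  insertAt ⁅ j ⁆ (inject₁ i) true
    ≡⟨ cong (λ S → insertAt S (inject₁ i) true) (⁅⁆≡insertAt-⊥ j) ⟩
  insertAt (insertAt ⊥ j true) (inject₁ i) true
    ≡⟨ insertAt-insertAt ⊥ true true i≤j ⟩
  insertAt (insertAt ⊥ i true) (suc j) true
    ≡⟨ cong (λ S → insertAt S (suc j) true) (⁅⁆≡insertAt-⊥ i) ⟨
  insertAt ⁅ i ⁆ (suc j) true
    ∎
  where open ≡-Reasoning

∁⁅⁆-insertAt-comm : ∀ {i j : Fin (suc n)} → i Fin.≤ j →
                    insertAt (∁ ⁅ j ⁆) (inject₁ i) false ≡ insertAt (∁ ⁅ i ⁆) (suc j) false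
∁⁅⁆-insertAt-comm {i = i} {j} i≤j = begin
  insertAt (∁ ⁅ j ⁆) (inject₁ i) false
    ≡⟨ cong (λ S → insertAt S (inject₁ i) false) (∁⁅⁆≡insertAt-⊤ j) ⟩
  insertAt (insertAt ⊤ j false) (inject₁ i) false
    ≡⟨ insertAt-insertAt ⊤ false false i≤j ⟩
  insertAt (insertAt ⊤ i false) (suc j) false
    ≡⟨ cong (λ S → insertAt S (suc j) false) (∁⁅⁆≡insertAt-⊤ i) ⟨
  insertAt (∁ ⁅ i ⁆) (suc j) false
    ∎
  where open ≡-Reasoning

insertAt-⊆ : ∀ {S T : Subset n} i a → S ⊆ T → insertAt S i a ⊆ insertAt T i a
insertAt-⊆                         zero    a S⊆T here        = here
insertAt-⊆                         zero    a S⊆T (there x∈S) = there (S⊆T x∈S)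
insertAt-⊆ {S = _ ∷ _} {T = _ ∷ _} (suc i) a S⊆T here        with S⊆T here
... | here = here
insertAt-⊆ {S = _ ∷ _} {T = _ ∷ _} (suc i) a S⊆T (there x∈S) =
  there (insertAt-⊆ i a (drop-∷-⊆ S⊆T) x∈S)

insertAt-∪ : ∀ (S T : Subset n) i a → insertAt S i a ∪ insertAt T i a ≡ insertAt (S ∪ T) i a
insertAt-∪ S T i a = trans (zipWith-insertAt _∨_ S T i a a) (cong (insertAt (S ∪ T) i) (∨-idem a))

insertAt-∩ : ∀ (S T : Subset n) i a → insertAt S i a ∩ insertAt T i a ≡ insertAt (S ∩ T) i a
insertAt-∩ S T i a = trans (zipWith-insertAt _∧_ S T i a a) (cong (insertAt (S ∩ T) i) (∧-idem a))

∣insertAt-false∣ : ∀ (S : Subset n) i → ∣ insertAt S i false ∣ ≡ ∣ S ∣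
∣insertAt-false∣ S            zero    = refl
∣insertAt-false∣ (true  ∷ S) (suc i) = cong suc (∣insertAt-false∣ S i)
∣insertAt-false∣ (false ∷ S) (suc i) = ∣insertAt-false∣ S i

⁅⁆∪insertAt-false : ∀ (i : Fin (suc n)) S → ⁅ i ⁆ ∪ insertAt S i false ≡ insertAt S i true
⁅⁆∪insertAt-false i S = begin
  ⁅ i ⁆ ∪ insertAt S i false               ≡⟨ cong (_∪ insertAt S i false) (⁅⁆≡insertAt-⊥ i) ⟩
  insertAt ⊥ i true ∪ insertAt S i false   ≡⟨ zipWith-insertAt _∨_ ⊥ S i true false ⟩
  insertAt (⊥ ∪ S) i true                  ≡⟨ cong (λ U → insertAt U i true) (∪-identityˡ S) ⟩
  insertAt S i true                        ∎
  where open ≡-Reasoning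

⁅⁆⊆insertAt-true : ∀ (i : Fin (suc n)) S → ⁅ i ⁆ ⊆ insertAt S i true
⁅⁆⊆insertAt-true i S = subst (_⊆ insertAt S i true) (sym (⁅⁆≡insertAt-⊥ i)) (insertAt-⊆ i true ⊥⊆)

[a<e⊎b<a]⇔b<e : ∀ {a b e} → b ≤ a → a ≤ e → (a < e ⊎ b < a) ⇔ b < e
[a<e⊎b<a]⇔b<e {a} {b} {e} b≤a a≤e = mk⇔ to from
  where
  to : a < e ⊎ b < a → b < e
  to (inj₁ a<e) = ≤-<-trans b≤a a<e
  to (inj₂ b<a) = <-≤-trans b<a a≤e

  from : b < e → a < e ⊎ b < a
  from b<e with a <? e
  ... | yes a<e = inj₁ a<e
  ... | no  a≮e = inj₂ (<-≤-trans b<e (≮⇒≥ a≮e))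

[a≡0⊎c∸a≡0]⇔c<2 : ∀ {a c} → a ≤ 1 → c ∸ a ≤ 1 → (a ≡ 0 ⊎ c ∸ a ≡ 0) ⇔ c < 2
[a≡0⊎c∸a≡0]⇔c<2 z≤n       c≤1 = mk⇔ (λ _ → s≤s c≤1) (λ _ → inj₁ refl)
[a≡0⊎c∸a≡0]⇔c<2 (s≤s z≤n) _   =
  mk⇔ (λ { (inj₁ ()) ; (inj₂ c∸1≡0) → s≤s (m∸n≡0⇒m≤n c∸1≡0) })
      (λ c<2 → inj₂ (m≤n⇒m∸n≡0 (s≤s⁻¹ c<2)))

[a∸k]+[b∸k]≤[c∸k]+[d∸k] : ∀ k {a b c d} → k ≤ a → k ≤ b → k ≤ c → k ≤ d →
                          a + b ≤ c + d → (a ∸ k) + (b ∸ k) ≤ (c ∸ k) + (d ∸ k)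
[a∸k]+[b∸k]≤[c∸k]+[d∸k] zero    _ _ _ _ ab≤cd = ab≤cd
[a∸k]+[b∸k]≤[c∸k]+[d∸k] (suc k) {suc a} {suc b} {suc c} {suc d}
                        (s≤s k≤a) (s≤s k≤b) (s≤s k≤c) (s≤s k≤d) ab≤cd =
  [a∸k]+[b∸k]≤[c∸k]+[d∸k] k k≤a k≤b k≤c k≤d
    (s≤s⁻¹ (subst₂ _≤_ (+-suc a b) (+-suc c d) (s≤s⁻¹ ab≤cd)))

-- Matroids

module _ {rk : Subset n → ℕ} (M : IsMatroid n rk) where
  open IsMatroid M

  rk-subadditive : ∀ S T → rk (S ∪ T) ≤ rk S + rk T
  rk-subadditive S T = ≤-trans (m≤m+n _ _) (rk-submodular S T)

  rk-⁅⁆≤1 : ∀ x → rk ⁅ x ⁆ ≤ 1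
  rk-⁅⁆≤1 x = subst (rk ⁅ x ⁆ ≤_) (∣⁅x⁆∣≡1 x) (rk-bounded ⁅ x ⁆)

  rank≤size : rank rk ≤ n
  rank≤size = subst (rank rk ≤_) (∣⊤∣≡n n) (rk-bounded ⊤)

module _ {rk : Subset (suc n) → ℕ} (M : IsMatroid (suc n) rk) (i : Fin (suc n)) (a : Bool) where
  open IsMatroid M

  insertAt-rk-monotone : ∀ {S T} → S ⊆ T → rk (insertAt S i a) ≤ rk (insertAt T i a)
  insertAt-rk-monotone S⊆T = rk-monotone (insertAt-⊆ i a S⊆T)

  insertAt-rk-submodular : ∀ S T → rk (insertAt (S ∪ T) i a) + rk (insertAt (S ∩ T) i a)
                                   ≤ rk (insertAt S i a) + rk (insertAt T i a)
  insertAt-rk-submodular S T =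
    subst₂ (λ U V → rk U + rk V ≤ rk (insertAt S i a) + rk (insertAt T i a))
           (insertAt-∪ S T i a) (insertAt-∩ S T i a) (rk-submodular (insertAt S i a) (insertAt T i a))

module _ {rk : Subset (suc n) → ℕ} (M : IsMatroid (suc n) rk) (x : Fin (suc n)) where
  open IsMatroid M

  delete-isMatroid : IsMatroid n (delete rk x)
  delete-isMatroid = record
    { rk-bounded    = λ S → subst (delete rk x S ≤_) (∣insertAt-false∣ S x) (rk-bounded (insertAt S x false))
    ; rk-monotone   = insertAt-rk-monotone M x false
    ; rk-submodular = insertAt-rk-submodular M x false
    }

  rk-⁅⁆≤insertAt-true : ∀ S → rk ⁅ x ⁆ ≤ rk (insertAt S x true)
  rk-⁅⁆≤insertAt-true S = rk-monotone (⁅⁆⊆insertAt-true x S)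

  contract≤delete : ∀ S → contract rk x S ≤ delete rk x S
  contract≤delete S = m≤n+o⇒m∸n≤o _ (rk ⁅ x ⁆)
    (subst (λ U → rk U ≤ rk ⁅ x ⁆ + delete rk x S) (⁅⁆∪insertAt-false x S)
           (rk-subadditive M ⁅ x ⁆ (insertAt S x false)))

  contract-isMatroid : IsMatroid n (contract rk x)
  contract-isMatroid = record
    { rk-bounded    = λ S → ≤-trans (contract≤delete S) (IsMatroid.rk-bounded delete-isMatroid S)
    ; rk-monotone   = λ S⊆T → ∸-monoˡ-≤ (rk ⁅ x ⁆) (insertAt-rk-monotone M x true S⊆T)
    ; rk-submodular = λ S T → [a∸k]+[b∸k]≤[c∸k]+[d∸k] (rk ⁅ x ⁆)
        (rk-⁅⁆≤insertAt-true (S ∪ T)) (rk-⁅⁆≤insertAt-true (S ∩ T))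
        (rk-⁅⁆≤insertAt-true S) (rk-⁅⁆≤insertAt-true T)
        (insertAt-rk-submodular M x true S T)
    }

  delete-rank : ¬ IsColoop rk x → rank (delete rk x) ≡ rank rk
  delete-rank ¬coloop =
    trans (cong rk (sym (∁⁅⁆≡insertAt-⊤ x))) (≤-antisym (rk-monotone ⊆⊤) (≮⇒≥ ¬coloop))

  delete-nullity : ¬ IsColoop rk x → suc (nullity n (delete rk x)) ≡ nullity (suc n) rk
  delete-nullity ¬coloop = begin
    suc (n ∸ rank (delete rk x))  ≡⟨ +-∸-assoc 1 (rank≤size delete-isMatroid) ⟨
    suc n ∸ rank (delete rk x)    ≡⟨ cong (suc n ∸_) (delete-rank ¬coloop) ⟩
    suc n ∸ rank rk               ∎
    where open ≡-Reasoning

  contract-rank : ¬ IsLoop rk x → suc (rank (contract rk x)) ≡ rank rk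
  contract-rank ¬loop = begin
    suc (rk (insertAt ⊤ x true) ∸ rk ⁅ x ⁆)
      ≡⟨ cong₂ (λ U k → suc (rk U ∸ k)) (insertAt-replicate x true) rk⁅x⁆≡1 ⟩
    suc (rk ⊤ ∸ 1)
      ≡⟨ m+[n∸m]≡n (≤-trans (n≢0⇒n>0 ¬loop) (rk-monotone ⊆⊤)) ⟩
    rk ⊤
      ∎
    where
    open ≡-Reasoning
    rk⁅x⁆≡1 : rk ⁅ x ⁆ ≡ 1
    rk⁅x⁆≡1 = ≤-antisym (rk-⁅⁆≤1 M x) (n≢0⇒n>0 ¬loop)

  contract-nullity : ¬ IsLoop rk x → nullity n (contract rk x) ≡ nullity (suc n) rk
  contract-nullity ¬loop = cong (suc n ∸_) (contract-rank ¬loop)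

module _ {rk : Subset (suc (suc n)) → ℕ} (M : IsMatroid (suc (suc n)) rk) where
  open IsMatroid M

  delete-comm : ∀ {i j : Fin (suc n)} → i Fin.≤ j →
                delete (delete rk (inject₁ i)) j ≗ delete (delete rk (suc j)) i
  delete-comm i≤j S = cong rk (insertAt-insertAt S false false i≤j)

  contract-contract : ∀ x y S → contract (contract rk x) y S
                                ≡ rk (insertAt (insertAt S y true) x true) ∸ rk (insertAt ⁅ y ⁆ x true)
  contract-contract x y S = begin
    (X ∸ rk ⁅ x ⁆) ∸ (Y ∸ rk ⁅ x ⁆)  ≡⟨ ∸-+-assoc X (rk ⁅ x ⁆) (Y ∸ rk ⁅ x ⁆) ⟩
    X ∸ (rk ⁅ x ⁆ + (Y ∸ rk ⁅ x ⁆))  ≡⟨ cong (X ∸_) (m+[n∸m]≡n (rk-⁅⁆≤insertAt-true M x ⁅ y ⁆)) ⟩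
    X ∸ Y                             ∎
    where
    open ≡-Reasoning
    X = rk (insertAt (insertAt S y true) x true)
    Y = rk (insertAt ⁅ y ⁆ x true)

  contract-comm : ∀ {i j : Fin (suc n)} → i Fin.≤ j →
                  contract (contract rk (inject₁ i)) j ≗ contract (contract rk (suc j)) i
  contract-comm {i} {j} i≤j S = begin
    contract (contract rk (inject₁ i)) j S
      ≡⟨ contract-contract (inject₁ i) j S ⟩
    rk (insertAt (insertAt S j true) (inject₁ i) true) ∸ rk (insertAt ⁅ j ⁆ (inject₁ i) true)
      ≡⟨ cong₂ (λ U V → rk U ∸ rk V) (insertAt-insertAt S true true i≤j) (⁅⁆-insertAt-comm i≤j) ⟩
    rk (insertAt (insertAt S i true) (suc j) true) ∸ rk (insertAt ⁅ i ⁆ (suc j) true)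
      ≡⟨ contract-contract (suc j) i S ⟨
    contract (contract rk (suc j)) i S
      ∎
    where open ≡-Reasoning

  coloop-pair : ∀ x y → (IsColoop rk x ⊎ IsColoop (delete rk x) y)
                        ⇔ rk (insertAt (∁ ⁅ y ⁆) x false) < rank rk
  coloop-pair x y =
    subst (λ U → (rk U < rk ⊤ ⊎ rk E∖xy < delete rk x ⊤) ⇔ rk E∖xy < rk ⊤) (sym (∁⁅⁆≡insertAt-⊤ x))
          ([a<e⊎b<a]⇔b<e (insertAt-rk-monotone M x false ⊆⊤) (rk-monotone ⊆⊤))
    where E∖xy = insertAt (∁ ⁅ y ⁆) x false

  loop-pair : ∀ x y → (IsLoop rk x ⊎ IsLoop (contract rk x) y) ⇔ rk (insertAt ⁅ y ⁆ x true) < 2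
  loop-pair x y = [a≡0⊎c∸a≡0]⇔c<2 (rk-⁅⁆≤1 M x) (rk-⁅⁆≤1 (contract-isMatroid M x) y)

  coloop-comm : ∀ {i j : Fin (suc n)} → i Fin.≤ j →
                (IsColoop rk (inject₁ i) ⊎ IsColoop (delete rk (inject₁ i)) j)
                ⇔ (IsColoop rk (suc j) ⊎ IsColoop (delete rk (suc j)) i)
  coloop-comm {i} {j} i≤j =
    ⇔-trans (coloop-pair (inject₁ i) j)
            (subst (λ U → rk U < rank rk ⇔ (IsColoop rk (suc j) ⊎ IsColoop (delete rk (suc j)) i))
                   (sym (∁⁅⁆-insertAt-comm i≤j)) (⇔-sym (coloop-pair (suc j) i)))

  loop-comm : ∀ {i j : Fin (suc n)} → i Fin.≤ j →
              (IsLoop rk (inject₁ i) ⊎ IsLoop (contract rk (inject₁ i)) j)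
              ⇔ (IsLoop rk (suc j) ⊎ IsLoop (contract rk (suc j)) i)
  loop-comm {i} {j} i≤j =
    ⇔-trans (loop-pair (inject₁ i) j)
            (subst (λ U → rk U < 2 ⇔ (IsLoop rk (suc j) ⊎ IsLoop (contract rk (suc j)) i))
                   (sym (⁅⁆-insertAt-comm i≤j)) (⇔-sym (loop-pair (suc j) i)))

-- Formal combinations

≈-setoid : Setoid 0ℓ 0ℓ
≈-setoid = record
  { Carrier       = Comb
  ; _≈_           = _≈_
  ; isEquivalence = record { refl = ≈-refl ; sym = ≈-sym ; trans = ≈-trans }
  }

module ≈-Reasoning = SetoidReasoning ≈-setoid

≈-++⁺ : ∀ {xs ys us vs} → xs ≈ ys → us ≈ vs → xs ++ us ≈ ys ++ vs
≈-++⁺ {xs} {ys} {us} {vs} xs≈ys us≈vs = begin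
  xs ++ us  ≈⟨ ≈-perm (++-comm xs us) ⟩
  us ++ xs  ≈⟨ ≈-++ us xs≈ys ⟩
  us ++ ys  ≈⟨ ≈-perm (++-comm us ys) ⟩
  ys ++ us  ≈⟨ ≈-++ ys us≈vs ⟩
  ys ++ vs  ∎
  where open ≈-Reasoning

concatMap-≈[] : ∀ (f : A → Comb) xs → (∀ x → f x ≈ []) → concatMap f xs ≈ []
concatMap-≈[] f []       _    = ≈-refl
concatMap-≈[] f (x ∷ xs) f≈[] = ≈-++⁺ (f≈[] x) (concatMap-≈[] f xs f≈[])

unless-cancel : ∀ {b b'} {xs ys : Comb} → b ≡ b' → xs ++ ys ≈ [] → unless b xs ++ unless b' ys ≈ []
unless-cancel {true}  refl _         = ≈-refl
unless-cancel {false} refl xs++ys≈[] = xs++ys≈[]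

-- With y relabelled by punchIn x, both (inject₁ i, j) and (suc j, i) stand for
-- removing the points i and j+1, and every (x, y) arises once in this way.
concatMap²-cancel : ∀ m (g : Fin (suc m) → Fin m → Comb) →
                    (∀ {i j} → i Fin.≤ j → g (inject₁ i) j ++ g (suc j) i ≈ []) →
                    concatMap (λ x → concatMap (g x) (allFin m)) (allFin (suc m)) ≈ []
concatMap²-cancel zero    g pairs = ≈-refl
concatMap²-cancel (suc m) g pairs = begin
    concatMap (λ x → concatMap (g x) (allFin (suc m))) (allFin (suc (suc m)))
  ≡⟨ concatMap-allFin-suc (λ x → concatMap (g x) (allFin (suc m))) ⟩
    Row ++ concatMap (λ x → concatMap (g (suc x)) (allFin (suc m))) (allFin (suc m))
  ≡⟨ cong (Row ++_) (concatMap-cong (λ x → concatMap-allFin-suc (g (suc x))) (allFin (suc m))) ⟩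
    Row ++ concatMap (λ x → Col x ++ Rest x) (allFin (suc m))
  ≈⟨ ≈-++ Row (≈-perm (concatMap-++-↭ Col Rest (allFin (suc m)))) ⟩
    Row ++ concatMap Col (allFin (suc m)) ++ concatMap Rest (allFin (suc m))
  ≡⟨ ++-assoc Row (concatMap Col (allFin (suc m))) _ ⟨
    (Row ++ concatMap Col (allFin (suc m))) ++ concatMap Rest (allFin (suc m))
  ≈⟨ ≈-perm (++⁺ʳ _ (↭-sym (concatMap-++-↭ (g zero) Col (allFin (suc m))))) ⟩
    concatMap (λ j → g zero j ++ g (suc j) zero) (allFin (suc m)) ++ concatMap Rest (allFin (suc m))
  ≈⟨ ≈-++⁺ (concatMap-≈[] _ (allFin (suc m)) (λ _ → pairs z≤n))
           (concatMap²-cancel m (λ x y → g (suc x) (suc y)) (λ i≤j → pairs (s≤s i≤j))) ⟩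
    [] ∎
  where
  open ≈-Reasoning
  Row  = concatMap (g zero) (allFin (suc m))
  Col  = λ x → g (suc x) zero
  Rest = λ x → concatMap (g (suc x) ∘ suc) (allFin m)

<ᵇ-asym : ∀ a b → ((a <ᵇ b) ∧ (b <ᵇ a)) ≡ false
<ᵇ-asym zero    zero    = refl
<ᵇ-asym zero    (suc b) = refl
<ᵇ-asym (suc a) zero    = refl
<ᵇ-asym (suc a) (suc b) = <ᵇ-asym a b

sum-map-zero : ∀ (f : A → ℕ) xs → (∀ x → f x ≡ 0) → sum (map f xs) ≡ 0
sum-map-zero f []       _   = refl
sum-map-zero f (x ∷ xs) f≡0 = cong₂ _+_ (f≡0 x) (sum-map-zero f xs f≡0)

signPerm-id : signPerm (idₚ {n}) ≡ Sign.+
signPerm-id {n} = cong signPow (sum-map-zero _ (allFin n) λ i → sum-map-zero _ (allFin n) λ j →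
  cong (λ b → if b then 1 else 0) (<ᵇ-asym (toℕ i) (toℕ j)))

≈-rk-≗ : ∀ q {n R R'} s → IsMatroid n R → IsMatroid n R' → R ≗ R' →
         [ (q , om n R s) ] ≈ [ (q , om n R' s) ]
≈-rk-≗ q {n} {R} {R'} s M M' R≗R' = begin
  [ (q , om n R s) ]
    ≈⟨ ≈-iso q n n R R' s M M' (idₚ {n}) R'∘id≗R ⟩
  [ (q , om n R' (signPerm (idₚ {n}) *ˢ s)) ]
    ≡⟨ cong (λ σ → [ (q , om n R' (σ *ˢ s)) ]) (signPerm-id {n}) ⟩
  [ (q , om n R' s) ]
    ∎
  where
  open ≈-Reasoning
  R'∘id≗R : ∀ S → R' (image idₚ S) ≡ R S
  R'∘id≗R S = trans (cong R' (tabulate∘lookup S)) (sym (R≗R' S))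

≈-opposite-cancel : ∀ {q n R R' s s'} → IsMatroid n R → IsMatroid n R' → R ≗ R' → s' ≡ opposite s →
                    [ (q , om n R s) ] ++ [ (q , om n R' s') ] ≈ []
≈-opposite-cancel {q} {n} {R} {R'} {s} M M' R≗R' refl = begin
  (q , om n R s) ∷ [ (q , om n R' (opposite s)) ]  ≈⟨ ≈-++ [ _ ] (≈-rk-≗ q (opposite s) M' M (sym ∘ R≗R')) ⟩
  (q , om n R s) ∷ [ (q , om n R (opposite s)) ]   ≈⟨ ≈-++ [ _ ] (≈-orient q n R s M) ⟩
  (q , om n R s) ∷ [ (- q , om n R s) ]            ≈⟨ ≈-merge q (- q) _ ⟩
  [ (q +ℚ - q , om n R s) ]                        ≡⟨ cong (λ a → [ (a , om n R s) ]) (+-inverseʳ q) ⟩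
  [ (0ℚ , om n R s) ]                              ≈⟨ ≈-zero _ ⟩
  []                                               ∎
  where open ≈-Reasoning

ιsign-anticomm : ∀ (i j : Fin (suc n)) s →
                 ιsign i (ιsign (suc j) s) ≡ opposite (ιsign j (ιsign (inject₁ i) s))
ιsign-anticomm i j s =
  trans (sign-law (signPow (toℕ i)) (signPow (toℕ j)) s)
        (cong (λ k → opposite (signPow (toℕ j) *ˢ (signPow k *ˢ s))) (sym (toℕ-inject₁ i)))
  where
  sign-law : ∀ a b s → a *ˢ (opposite b *ˢ s) ≡ opposite (b *ˢ (a *ˢ s))
  sign-law Sign.+ Sign.+ Sign.+ = refl
  sign-law Sign.+ Sign.+ Sign.- = refl
  sign-law Sign.+ Sign.- Sign.+ = refl
  sign-law Sign.+ Sign.- Sign.- = refl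
  sign-law Sign.- Sign.+ Sign.+ = refl
  sign-law Sign.- Sign.+ Sign.- = refl
  sign-law Sign.- Sign.- Sign.+ = refl
  sign-law Sign.- Sign.- Sign.- = refl

-- Boundary maps defined by a removal operation

record Removal : Set₁ where
  field
    remove           : ∀ {n} → (Subset (suc n) → ℕ) → Fin (suc n) → Subset n → ℕ
    Blocked          : ∀ {n} → (Subset (suc n) → ℕ) → Fin (suc n) → Set
    blocked?         : ∀ {n} (rk : Subset (suc n) → ℕ) x → Dec (Blocked rk x)
    remove-isMatroid : ∀ {n} {rk : Subset (suc n) → ℕ} → IsMatroid (suc n) rk →
                       ∀ x → IsMatroid n (remove rk x)
    remove-comm      : ∀ {n} {rk : Subset (suc (suc n)) → ℕ} → IsMatroid (suc (suc n)) rk →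
                       ∀ {i j} → i Fin.≤ j → remove (remove rk (inject₁ i)) j ≗ remove (remove rk (suc j)) i
    blocked-comm     : ∀ {n} {rk : Subset (suc (suc n)) → ℕ} → IsMatroid (suc (suc n)) rk →
                       ∀ {i j} → i Fin.≤ j →
                       (Blocked rk (inject₁ i) ⊎ Blocked (remove rk (inject₁ i)) j)
                       ⇔ (Blocked rk (suc j) ⊎ Blocked (remove rk (suc j)) i)

module Boundary (R : Removal) where
  open Removal R
  open ≈-Reasoning

  face : ∀ {n} → ℚ → (Subset (suc n) → ℕ) → Sign → Fin (suc n) → Comb
  face {n} q rk s x = unless (does (blocked? rk x)) [ (q , om n (remove rk x) (ιsign x s)) ]

  ∂₁ : ℚ × OM → Comb
  ∂₁ (q , om zero    rk s) = []
  ∂₁ (q , om (suc n) rk s) = concatMap (face q rk s) (allFin (suc n))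

  ∂ : Comb → Comb
  ∂ = concatMap ∂₁

  face² : ∀ {n} → ℚ → (Subset (suc (suc n)) → ℕ) → Sign → Fin (suc (suc n)) → Fin (suc n) → Comb
  face² q rk s x = unless (does (blocked? rk x)) ∘ face q (remove rk x) (ιsign x s)

  ∂∘face : ∀ {n} q (rk : Subset (suc n) → ℕ) s x →
           ∂ (face q rk s x) ≡ unless (does (blocked? rk x)) (∂₁ (q , om n (remove rk x) (ιsign x s)))
  ∂∘face {n} q rk s x = trans (concatMap-unless ∂₁ b [ t ]) (cong (unless b) (++-identityʳ (∂₁ t)))
    where
    b = does (blocked? rk x)
    t = (q , om n (remove rk x) (ιsign x s))

  face²-cancel : ∀ {n q s} {rk : Subset (suc (suc n)) → ℕ} → IsMatroid _ rk →
                 ∀ {i j} → i Fin.≤ j → face² q rk s (inject₁ i) j ++ face² q rk s (suc j) i ≈ []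
  face²-cancel {n} {q} {s} {rk} M {i} {j} i≤j = begin
      face² q rk s (inject₁ i) j ++ face² q rk s (suc j) i
    ≡⟨ cong₂ _++_ (unless-unless b₁ b₂ [ t₁ ]) (unless-unless c₁ c₂ [ t₂ ]) ⟩
      unless (does P?) [ t₁ ] ++ unless (does Q?) [ t₂ ]
    ≈⟨ unless-cancel {does P?} {does Q?} {[ t₁ ]} {[ t₂ ]} (does-⇔ (blocked-comm M i≤j) P? Q?)
         (≈-opposite-cancel (remove-isMatroid (remove-isMatroid M (inject₁ i)) j)
                            (remove-isMatroid (remove-isMatroid M (suc j)) i)
                            (remove-comm M i≤j) (ιsign-anticomm i j s)) ⟩
      [] ∎
    where
    b₁ = does (blocked? rk (inject₁ i))
    b₂ = does (blocked? (remove rk (inject₁ i)) j)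
    c₁ = does (blocked? rk (suc j))
    c₂ = does (blocked? (remove rk (suc j)) i)
    P? = blocked? rk (inject₁ i) ⊎-dec blocked? (remove rk (inject₁ i)) j
    Q? = blocked? rk (suc j) ⊎-dec blocked? (remove rk (suc j)) i
    t₁ = (q , om n (remove (remove rk (inject₁ i)) j) (ιsign j (ιsign (inject₁ i) s)))
    t₂ = (q , om n (remove (remove rk (suc j)) i) (ιsign i (ιsign (suc j) s)))

  ∂∘∂₁≈[] : ∀ t → IsMatroidTerm t → ∂ (∂₁ t) ≈ []
  ∂∘∂₁≈[] (q , om zero rk s) _ = ≈-refl
  ∂∘∂₁≈[] (q , om (suc zero) rk s) _ = begin
      ∂ (concatMap (face q rk s) (allFin 1))
    ≡⟨ concatMap-concatMap ∂₁ (face q rk s) (allFin 1) ⟩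
      concatMap (∂ ∘ face q rk s) (allFin 1)
    ≡⟨ concatMap-cong (λ x → trans (∂∘face q rk s x) (unless-[] _)) (allFin 1) ⟩
      [] ∎
  ∂∘∂₁≈[] (q , om (suc (suc n)) rk s) M = begin
      ∂ (concatMap (face q rk s) (allFin (suc (suc n))))
    ≡⟨ concatMap-concatMap ∂₁ (face q rk s) (allFin (suc (suc n))) ⟩
      concatMap (∂ ∘ face q rk s) (allFin (suc (suc n)))
    ≡⟨ concatMap-cong ∂∘face≡face² (allFin (suc (suc n))) ⟩
      concatMap (λ x → concatMap (face² q rk s x) (allFin (suc n))) (allFin (suc (suc n)))
    ≈⟨ concatMap²-cancel (suc n) (face² q rk s) (face²-cancel M) ⟩
      [] ∎
    where
    ∂∘face≡face² : ∀ x → ∂ (face q rk s x) ≡ concatMap (face² q rk s x) (allFin (suc n))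
    ∂∘face≡face² x =
      trans (∂∘face q rk s x)
            (unless-concatMap (face q (remove rk x) (ιsign x s)) (does (blocked? rk x)) (allFin (suc n)))

  ∂∘∂≈[] : ∀ xs → All IsMatroidTerm xs → ∂ (∂ xs) ≈ []
  ∂∘∂≈[] []       []       = ≈-refl
  ∂∘∂≈[] (t ∷ xs) (M ∷ Ms) = begin
    ∂ (∂₁ t ++ ∂ xs)      ≡⟨ concatMap-++ ∂₁ (∂₁ t) (∂ xs) ⟩
    ∂ (∂₁ t) ++ ∂ (∂ xs)  ≈⟨ ≈-++⁺ (∂∘∂₁≈[] t M) (∂∘∂≈[] xs Ms) ⟩
    []                    ∎

  ∈-∂-singleton : ∀ {v} q {n} rk s → v ∈ ∂ [ (q , om (suc n) rk s) ] →
                  ∃[ x ] ¬ Blocked rk x × v ≡ (q , om n (remove rk x) (ιsign x s))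
  ∈-∂-singleton q rk s v∈ with ∈-++⁻ (∂₁ (q , om _ rk s)) v∈
  ... | inj₁ v∈faces with satisfied (∈-concatMap⁻ (face q rk s) {xs = allFin _} v∈faces)
  ...   | x , v∈face with ∈-unless (blocked? rk x) v∈face
  ...     | ¬blocked , here v≡t = x , ¬blocked , v≡t

-- Deletion and contraction

deletion : Removal
deletion = record
  { remove           = delete
  ; Blocked          = IsColoop
  ; blocked?         = λ rk x → rk (∁ ⁅ x ⁆) <? rk ⊤
  ; remove-isMatroid = delete-isMatroid
  ; remove-comm      = delete-comm
  ; blocked-comm     = coloop-comm
  }

contraction : Removal
contraction = record
  { remove           = contract
  ; Blocked          = IsLoop
  ; blocked?         = λ rk x → rk ⁅ x ⁆ ≟ 0
  ; remove-isMatroid = contract-isMatroid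
  ; remove-comm      = contract-comm
  ; blocked-comm     = loop-comm
  }

module Deletion    = Boundary deletion
module Contraction = Boundary contraction

∂del≗ : ∀ xs → ∂del xs ≡ Deletion.∂ xs
∂del≗ = concatMap-cong λ where
  (q , om zero    rk s) → refl
  (q , om (suc n) rk s) → refl

∂con≗ : ∀ xs → ∂con xs ≡ Contraction.∂ xs
∂con≗ = concatMap-cong λ where
  (q , om zero    rk s) → refl
  (q , om (suc n) rk s) → refl

∂del∘∂del≈[] : ∀ xs → All IsMatroidTerm xs → ∂del (∂del xs) ≈ []
∂del∘∂del≈[] xs Ms = begin
  ∂del (∂del xs)               ≡⟨ ∂del≗ (∂del xs) ⟩
  Deletion.∂ (∂del xs)         ≡⟨ cong Deletion.∂ (∂del≗ xs) ⟩
  Deletion.∂ (Deletion.∂ xs)   ≈⟨ Deletion.∂∘∂≈[] xs Ms ⟩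
  []                           ∎
  where open ≈-Reasoning

∂con∘∂con≈[] : ∀ xs → All IsMatroidTerm xs → ∂con (∂con xs) ≈ []
∂con∘∂con≈[] xs Ms = begin
  ∂con (∂con xs)                     ≡⟨ ∂con≗ (∂con xs) ⟩
  Contraction.∂ (∂con xs)            ≡⟨ cong Contraction.∂ (∂con≗ xs) ⟩
  Contraction.∂ (Contraction.∂ xs)   ≈⟨ Contraction.∂∘∂≈[] xs Ms ⟩
  []                                 ∎
  where open ≈-Reasoning

∂del-bidegree : ∀ (q : ℚ) g → IsMatroid (size g) (rk g) → ∀ {p g'} → (p , g') ∈ ∂del [ (q , g) ] →
                suc (nullity (size g') (rk g')) ≡ nullity (size g) (rk g) × rank (rk g') ≡ rank (rk g)
∂del-bidegree q (om zero    rk s) M ()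
∂del-bidegree q (om (suc n) rk s) M p∈ with Deletion.∈-∂-singleton q rk s p∈
... | x , ¬coloop , refl = delete-nullity M x ¬coloop , delete-rank M x ¬coloop

∂con-bidegree : ∀ (q : ℚ) g → IsMatroid (size g) (rk g) → ∀ {p g'} → (p , g') ∈ ∂con [ (q , g) ] →
                nullity (size g') (rk g') ≡ nullity (size g) (rk g) × suc (rank (rk g')) ≡ rank (rk g)
∂con-bidegree q (om zero    rk s) M ()
∂con-bidegree q (om (suc n) rk s) M p∈ with Contraction.∈-∂-singleton q rk s p∈
... | x , ¬loop , refl = contract-nullity M x ¬loop , contract-rank M x ¬loop

lemma3p8 :
    (∀ xs → All IsMatroidTerm xs → ∂del (∂del xs) ≈ [])
    × (∀ xs → All IsMatroidTerm xs → ∂con (∂con xs) ≈ [])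
    × (∀ (q : ℚ) g → IsMatroid (size g) (rk g) → ∀ {p g'} → (p , g') ∈ ∂del [ (q , g) ] →
         suc (nullity (size g') (rk g')) ≡ nullity (size g) (rk g)
         × rank (rk g') ≡ rank (rk g))
    × (∀ (q : ℚ) g → IsMatroid (size g) (rk g) → ∀ {p g'} → (p , g') ∈ ∂con [ (q , g) ] →
         nullity (size g') (rk g') ≡ nullity (size g) (rk g)
         × suc (rank (rk g')) ≡ rank (rk g))
lemma3p8 = ∂del∘∂del≈[] , ∂con∘∂con≈[] , ∂del-bidegree , ∂con-bidegree
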